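{- The function $\Phi_0=\Phi_0(u,v,w;z)$ satisfies the differential equation (in $z$, with $|z|<1$) $$z(1-z^2)\Phi_0''+\big[(1-u)(1-z^2)-vz^2\big]\Phi_0'+(uv-w)z\Phi_0=1.$$
   Context: An index $\mathbf{k}=(k_1,\ldots,k_n)$ of positive integers has weight $k_1+\cdots+k_n$, depth $n$, height $|\{j:k_j\ge2\}|$, and is admissible if $k_1>1$. For an index, $\mathcal{L}_{\mathbf{k}}(z)=\sum_{m_1>\cdots>m_n>0,\ m_i\text{ odd}}\frac{z^{m_1}}{m_1^{k_1}\cdots m_n^{k_n}}$ for $|z|<1$. For nonnegative integers $k,n,s$, $I_0(k,n,s)$ is the set of admissible indices of weight $k$, depth $n$, height $s$, and $G_0(k,n,s;z)=\sum_{\mathbf{k}\in I_0(k,n,s)}\mathcal{L}_{\mathbf{k}}(z)$ (zero if the set is empty). For formal variables $u,v,w$, $\Phi_0(u,v,w;z)=\sum_{k\ge n+s,\ n\ge s\ge1}G_0(k,n,s;z)u^{k-n-s}v^{n-s}w^{s-1}$, a formal power series in $u,v,w$ with coefficients functions of $z$; primes denote $d/dz$. -}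

module Defs where

open import Data.Nat as ℕ using (ℕ; zero; suc; _∸_; _≤ᵇ_; _≡ᵇ_)
open import Data.Integer using (+_)
open import Data.Rational using (ℚ; 0ℚ; 1ℚ; _+_; _*_; _-_; -_; _/_)
open import Data.Bool using (Bool; true; false; if_then_else_; _∧_)
open import Data.List using (List; []; _∷_; map; concatMap; filterᵇ; length; foldr; upTo)

sumTo : ℕ → (ℕ → ℚ) → ℚ
sumTo zero    f = f 0
sumTo (suc n) f = sumTo n f + f (suc n)

sumL : List ℚ → ℚ
sumL = foldr _+_ 0ℚ

prodL : List ℚ → ℚ
prodL = foldr _*_ 1ℚ

powℚ : ℚ → ℕ → ℚ
powℚ q zero    = 1ℚ
powℚ q (suc k) = q * powℚ q k

fromℕ : ℕ → ℚ
fromℕ n = + n / 1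

compositions : ℕ → ℕ → List (List ℕ)
compositions zero    zero    = [] ∷ []
compositions (suc _) zero    = []
compositions k       (suc n) =
  concatMap (λ j → map (suc j ∷_) (compositions (k ∸ suc j) n)) (upTo k)

weight : List ℕ → ℕ
weight = foldr ℕ._+_ 0

height : List ℕ → ℕ
height []       = 0
height (k ∷ ks) = (if 2 ≤ᵇ k then 1 else 0) ℕ.+ height ks

admissible : List ℕ → Bool
admissible []      = false
admissible (k ∷ _) = 2 ≤ᵇ k

I₀ : ℕ → ℕ → ℕ → List (List ℕ)
I₀ k n s = filterᵇ (λ ks → admissible ks ∧ (height ks ≡ᵇ s)) (compositions k n)

-- Strictly decreasing sequences of odd positive integers.
-- An odd positive integer 2j+1 is encoded by j.
-- decOdd n b : all sequences (j₁,…,jₙ) with b > j₁ > ⋯ > jₙ ≥ 0,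
-- i.e. (m₁,…,mₙ) = (2j₁+1,…,2jₙ+1) with 2b+1 > m₁ > ⋯ > mₙ > 0, mᵢ odd.
decOdd : ℕ → ℕ → List (List ℕ)
decOdd zero    b = [] ∷ []
decOdd (suc n) b = concatMap (λ j → map (j ∷_) (decOdd n j)) (upTo b)

invOddPow : ℕ → ℕ → ℚ
invOddPow j k = powℚ (+ 1 / suc (j ℕ.* 2)) k

term : List ℕ → List ℕ → ℚ
term (k ∷ ks) (j ∷ js) = invOddPow j k * term ks js
term _        _        = 1ℚ

-- coefficient of z^m in 𝓛_𝐤(z) = Σ_{m=m₁>⋯>mₙ>0, mᵢ odd} 1/(m₁^{k₁}⋯mₙ^{kₙ})
isOdd : ℕ → Bool
isOdd m = (m ℕ.% 2) ≡ᵇ 1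

headIs : ℕ → List ℕ → Bool
headIs j []      = false
headIs j (i ∷ _) = i ≡ᵇ j

Lcoef : List ℕ → ℕ → ℚ
Lcoef ks m =
  if isOdd m
  then sumL (map (term ks)
          (filterᵇ (headIs (m ℕ./ 2)) (decOdd (length ks) (suc (m ℕ./ 2)))))
  else 0ℚ

G₀coef : ℕ → ℕ → ℕ → ℕ → ℚ
G₀coef k n s m = sumL (map (λ ks → Lcoef ks m) (I₀ k n s))

-- Formal power series in u, v, w, z with rational coefficients.
-- f a b c m = coefficient of u^a v^b w^c z^m.

Series : Set
Series = ℕ → ℕ → ℕ → ℕ → ℚ

infixl 6 _⊕_ _⊖_
infixl 7 _⊛_

_⊕_ : Series → Series → Series
(f ⊕ g) a b c m = f a b c m + g a b c m

_⊖_ : Series → Series → Series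
(f ⊖ g) a b c m = f a b c m - g a b c m

_⊛_ : Series → Series → Series
(f ⊛ g) a b c m =
  sumTo a λ a₁ → sumTo b λ b₁ → sumTo c λ c₁ → sumTo m λ m₁ →
    f a₁ b₁ c₁ m₁ * g (a ∸ a₁) (b ∸ b₁) (c ∸ c₁) (m ∸ m₁)

D : Series → Series
D f a b c m = fromℕ (suc m) * f a b c (suc m)

monomial : ℕ → ℕ → ℕ → ℕ → Series
monomial a₀ b₀ c₀ m₀ a b c m =
  if (a ≡ᵇ a₀) ∧ (b ≡ᵇ b₀) ∧ (c ≡ᵇ c₀) ∧ (m ≡ᵇ m₀) then 1ℚ else 0ℚ

𝟙 𝕦 𝕧 𝕨 𝕫 : Series
𝟙 = monomial 0 0 0 0
𝕦 = monomial 1 0 0 0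
𝕧 = monomial 0 1 0 0
𝕨 = monomial 0 0 1 0
𝕫 = monomial 0 0 0 1

-- Φ₀(u,v,w;z) = Σ_{k ≥ n+s, n ≥ s ≥ 1} G₀(k,n,s;z) u^{k-n-s} v^{n-s} w^{s-1}.
-- The monomial u^a v^b w^c arises exactly from s = c+1, n = b+s, k = a+n+s.
Φ₀ : Series
Φ₀ a b c m = G₀coef (a ℕ.+ n ℕ.+ s) n s m
  where
  s = suc c
  n = b ℕ.+ s

ODE-LHS : Series → Series
ODE-LHS Φ =
    𝕫 ⊛ (𝟙 ⊖ 𝕫 ⊛ 𝕫) ⊛ D (D Φ)
  ⊕ ((𝟙 ⊖ 𝕦) ⊛ (𝟙 ⊖ 𝕫 ⊛ 𝕫) ⊖ 𝕧 ⊛ 𝕫 ⊛ 𝕫) ⊛ D Φ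
  ⊕ (𝕦 ⊛ 𝕧 ⊖ 𝕨) ⊛ 𝕫 ⊛ Φ

-- Let Ψ be the generating function of the non-admissible indices (1, 𝐤), where uᵃvᵇwᶜ
-- marks the 𝐤 of weight a + (b + c) + c, depth b + c and height c.  Lowering the first
-- entry of an admissible index yields either an admissible index or one starting with 1,
-- and z 𝓛′_{(k₁+1, …)} = 𝓛_{(k₁, …)}; hence z Φ₀′ = u Φ₀ + Ψ.  Since
-- (1 − z²) 𝓛′_{(1, 𝐤)} = z 𝓛_𝐤 for 𝐤 ≠ () and (1 − z²) 𝓛′_{(1)} = 1, splitting 𝐤 into
-- admissible indices and indices starting with 1 gives (1 − z²) Ψ′ = 1 + z (w Φ₀ + v Ψ).
-- Eliminating Ψ between these two first-order equations gives the second-order one.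

module Submission where

open import Defs
import Algebra.Properties.Ring
open import Data.Bool using (Bool; true; false; if_then_else_; _∧_)
open import Data.Bool.Properties using (∧-zeroʳ; if-eta)
import Data.Integer as ℤ
import Data.Integer.Properties as ℤ
open import Data.List using (List; []; _∷_; map; concatMap; filterᵇ; length; upTo; applyUpTo; _++_)
import Data.List.Properties as List
open import Data.Nat as ℕ using (ℕ; zero; suc; _∸_; _≡ᵇ_)
import Data.Nat.Coprimality as Coprime
open import Data.Nat.DivMod using ([m+kn]%n≡m%n; m*n%n≡0; m*n/n≡m; +-distrib-/-∣ʳ)
open import Data.Nat.Divisibility using (divides-refl)
import Data.Nat.Properties as ℕ
open import Data.Rational using (ℚ; mkℚ; 0ℚ; 1ℚ; _+_; _*_; _-_; _/_)
open import Data.Rational.Properties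
open import Data.Rational.Solver using (module +-*-Solver)
open import Data.Sum using (_⊎_; inj₁; inj₂)
open import Function using (_∘_)
open import Level using (0ℓ)
open import Relation.Binary.Bundles using (Setoid)
open import Relation.Binary.PropositionalEquality
import Relation.Binary.Reasoning.Setoid as SetoidReasoning

open +-*-Solver using (solve; _:=_; _:+_; _:-_; _:*_)
open Algebra.Properties.Ring +-*-ring using (x[y-z]≈xy-xz; [y-z]x≈yx-zx)

[w+x]-[y+z]≡[w-y]+[x-z] : ∀ w x y z → (w + x) - (y + z) ≡ (w - y) + (x - z)
[w+x]-[y+z]≡[w-y]+[x-z] = solve 4 (λ w x y z → (w :+ x) :- (y :+ z) := (w :- y) :+ (x :- z)) refl

[x+y]-x≡y : ∀ x y → x + y - x ≡ y
[x+y]-x≡y = solve 2 (λ x y → x :+ y :- x := y) refl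

*-if : ∀ q b x → q * (if b then x else 0ℚ) ≡ (if b then q * x else 0ℚ)
*-if q true  x = refl
*-if q false x = *-zeroʳ q

fromℕ≡mkℚ : ∀ n → fromℕ n ≡ mkℚ (ℤ.+ n) 0 (Coprime.sym (Coprime.1-coprimeTo n))
fromℕ≡mkℚ n = normalize-coprime (Coprime.sym (Coprime.1-coprimeTo n))

fromℕ-suc : ∀ n → fromℕ (suc n) ≡ 1ℚ + fromℕ n
fromℕ-suc n = sym (trans (cong (1ℚ +_) (fromℕ≡mkℚ n))
                         (cong (λ z → (ℤ.+ 1 ℤ.+ z) / 1) (ℤ.*-identityʳ (ℤ.+ n))))

fromℕ-*-inverse : ∀ n → fromℕ (suc n) * (ℤ.+ 1 / suc n) ≡ 1ℚ
fromℕ-*-inverse n =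
  trans (cong₂ _*_ (fromℕ≡mkℚ (suc n)) (normalize-coprime (Coprime.1-coprimeTo (suc n))))
        (*-inverseʳ (mkℚ (ℤ.+ suc n) 0 (Coprime.sym (Coprime.1-coprimeTo (suc n)))))

sumL-++ : ∀ xs ys → sumL (xs ++ ys) ≡ sumL xs + sumL ys
sumL-++ []       ys = sym (+-identityˡ (sumL ys))
sumL-++ (x ∷ xs) ys = trans (cong (x +_) (sumL-++ xs ys)) (sym (+-assoc x (sumL xs) (sumL ys)))

module _ {A : Set} where

  sumL-map-cong : ∀ {F G : A → ℚ} → (∀ x → F x ≡ G x) → ∀ xs → sumL (map F xs) ≡ sumL (map G xs)
  sumL-map-cong F≡G []       = refl
  sumL-map-cong F≡G (x ∷ xs) = cong₂ _+_ (F≡G x) (sumL-map-cong F≡G xs)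

  sumL-map-zero : ∀ {F : A → ℚ} → (∀ x → F x ≡ 0ℚ) → ∀ xs → sumL (map F xs) ≡ 0ℚ
  sumL-map-zero F≡0 []       = refl
  sumL-map-zero F≡0 (x ∷ xs) = cong₂ _+_ (F≡0 x) (sumL-map-zero F≡0 xs)

  *-sumL-map : ∀ q (F : A → ℚ) xs → q * sumL (map F xs) ≡ sumL (map (λ x → q * F x) xs)
  *-sumL-map q F []       = *-zeroʳ q
  *-sumL-map q F (x ∷ xs) = trans (*-distribˡ-+ q (F x) _) (cong (q * F x +_) (*-sumL-map q F xs))

  sumL-map-minus : ∀ (F G : A → ℚ) xs →
                   sumL (map F xs) - sumL (map G xs) ≡ sumL (map (λ x → F x - G x) xs)
  sumL-map-minus F G []       = refl
  sumL-map-minus F G (x ∷ xs) =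
    trans ([w+x]-[y+z]≡[w-y]+[x-z] (F x) _ (G x) _) (cong (F x - G x +_) (sumL-map-minus F G xs))

  sumL-map-filterᵇ : ∀ (F : A → ℚ) p xs →
                     sumL (map F (filterᵇ p xs)) ≡ sumL (map (λ x → if p x then F x else 0ℚ) xs)
  sumL-map-filterᵇ F p []       = refl
  sumL-map-filterᵇ F p (x ∷ xs) with p x
  ... | true  = cong (F x +_) (sumL-map-filterᵇ F p xs)
  ... | false = trans (sumL-map-filterᵇ F p xs) (sym (+-identityˡ _))

sumL-map-if : ∀ {A : Set} p (F : A → ℚ) xs →
              sumL (map (λ x → if p then F x else 0ℚ) xs) ≡ (if p then sumL (map F xs) else 0ℚ)
sumL-map-if true  F xs = refl
sumL-map-if false F xs = sumL-map-zero (λ _ → refl) xs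

sumL-map-concatMap : ∀ {A B : Set} (F : B → ℚ) (g : A → List B) xs →
                     sumL (map F (concatMap g xs)) ≡ sumL (map (λ x → sumL (map F (g x))) xs)
sumL-map-concatMap F g []       = refl
sumL-map-concatMap F g (x ∷ xs) = begin
  sumL (map F (g x ++ concatMap g xs))               ≡⟨ cong sumL (List.map-++ F (g x) _) ⟩
  sumL (map F (g x) ++ map F (concatMap g xs))       ≡⟨ sumL-++ (map F (g x)) _ ⟩
  sumL (map F (g x)) + sumL (map F (concatMap g xs)) ≡⟨ cong (sumL (map F (g x)) +_) (sumL-map-concatMap F g xs) ⟩
  sumL (map F (g x)) + sumL (map (λ y → sumL (map F (g y))) xs) ∎
  where open ≡-Reasoning

sumL-map-prefixed : ∀ (F : List ℕ → ℚ) (h : ℕ → ℕ) (L : ℕ → List (List ℕ)) xs →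
                    sumL (map F (concatMap (λ j → map (h j ∷_) (L j)) xs))
                    ≡ sumL (map (λ j → sumL (map (λ ks → F (h j ∷ ks)) (L j))) xs)
sumL-map-prefixed F h L xs = trans (sumL-map-concatMap F _ xs)
  (sumL-map-cong (λ j → cong sumL (sym (List.map-∘ (L j)))) xs)

sumL-applyUpTo-zero : ∀ k (f : ℕ → ℚ) → (∀ j → j ℕ.< k → f j ≡ 0ℚ) → sumL (applyUpTo f k) ≡ 0ℚ
sumL-applyUpTo-zero zero    f f≡0 = refl
sumL-applyUpTo-zero (suc k) f f≡0 =
  cong₂ _+_ (f≡0 0 (ℕ.s≤s ℕ.z≤n)) (sumL-applyUpTo-zero k (f ∘ suc) (λ j j<k → f≡0 (suc j) (ℕ.s≤s j<k)))

sumTo-cong : ∀ n {f g : ℕ → ℚ} → (∀ i → f i ≡ g i) → sumTo n f ≡ sumTo n g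
sumTo-cong zero    f≡g = f≡g 0
sumTo-cong (suc n) f≡g = cong₂ _+_ (sumTo-cong n f≡g) (f≡g (suc n))

sumTo-zero : ∀ n {f : ℕ → ℚ} → (∀ i → f i ≡ 0ℚ) → sumTo n f ≡ 0ℚ
sumTo-zero zero    f≡0 = f≡0 0
sumTo-zero (suc n) f≡0 = cong₂ _+_ (sumTo-zero n f≡0) (f≡0 (suc n))

*-sumTo : ∀ n q (f : ℕ → ℚ) → q * sumTo n f ≡ sumTo n (λ i → q * f i)
*-sumTo zero    q f = refl
*-sumTo (suc n) q f = trans (*-distribˡ-+ q _ _) (cong (_+ q * f (suc n)) (*-sumTo n q f))

sumTo-minus : ∀ n (f g : ℕ → ℚ) → sumTo n f - sumTo n g ≡ sumTo n (λ i → f i - g i)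
sumTo-minus zero    f g = refl
sumTo-minus (suc n) f g =
  trans ([w+x]-[y+z]≡[w-y]+[x-z] (sumTo n f) (f (suc n)) (sumTo n g) (g (suc n)))
        (cong (_+ (f (suc n) - g (suc n))) (sumTo-minus n f g))

sumTo-suc : ∀ n (f : ℕ → ℚ) → sumTo (suc n) f ≡ f 0 + sumTo n (f ∘ suc)
sumTo-suc zero    f = refl
sumTo-suc (suc n) f = trans (cong (_+ f (suc (suc n))) (sumTo-suc n f)) (+-assoc (f 0) _ _)

sumL-applyUpTo : ∀ n (f : ℕ → ℚ) → sumL (applyUpTo f (suc n)) ≡ sumTo n f
sumL-applyUpTo zero    f = +-identityʳ (f 0)
sumL-applyUpTo (suc n) f = trans (cong (f 0 +_) (sumL-applyUpTo n (f ∘ suc))) (sym (sumTo-suc n f))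

sumL-map-upTo : ∀ n (f : ℕ → ℚ) → sumL (map f (upTo (suc n))) ≡ sumTo n f
sumL-map-upTo n f = trans (cong sumL (List.map-upTo f (suc n))) (sumL-applyUpTo n f)

sumTo-at-last : ∀ n (f : ℕ → ℚ) → sumTo n (λ i → if i ≡ᵇ n then f i else 0ℚ) ≡ f n
sumTo-at-last zero    f = refl
sumTo-at-last (suc n) f = trans (sumTo-suc n (λ i → if i ≡ᵇ suc n then f i else 0ℚ))
  (trans (+-identityˡ _) (sumTo-at-last n (f ∘ suc)))

shift₁ : ℕ → (ℕ → ℚ) → ℕ → ℚ
shift₁ zero    F n       = F n
shift₁ (suc j) F zero    = 0ℚ
shift₁ (suc j) F (suc n) = shift₁ j F n

shift₁-cong : ∀ j {F G : ℕ → ℚ} → (∀ n → F n ≡ G n) → ∀ n → shift₁ j F n ≡ shift₁ j G n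
shift₁-cong zero    F≡G n       = F≡G n
shift₁-cong (suc j) F≡G zero    = refl
shift₁-cong (suc j) F≡G (suc n) = shift₁-cong j F≡G n

shift₁-zero : ∀ j {F : ℕ → ℚ} → (∀ n → F n ≡ 0ℚ) → ∀ n → shift₁ j F n ≡ 0ℚ
shift₁-zero zero    F≡0 n       = F≡0 n
shift₁-zero (suc j) F≡0 zero    = refl
shift₁-zero (suc j) F≡0 (suc n) = shift₁-zero j F≡0 n

shift₁-map : ∀ (h : ℚ → ℚ) → h 0ℚ ≡ 0ℚ → ∀ j F n → shift₁ j (h ∘ F) n ≡ h (shift₁ j F n)
shift₁-map h h0≡0 zero    F n       = refl
shift₁-map h h0≡0 (suc j) F zero    = sym h0≡0
shift₁-map h h0≡0 (suc j) F (suc n) = shift₁-map h h0≡0 j F n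

shift₁-zipWith : ∀ (_∙_ : ℚ → ℚ → ℚ) → 0ℚ ∙ 0ℚ ≡ 0ℚ → ∀ j F G n →
                 shift₁ j (λ x → F x ∙ G x) n ≡ shift₁ j F n ∙ shift₁ j G n
shift₁-zipWith _∙_ 0∙0≡0 zero    F G n       = refl
shift₁-zipWith _∙_ 0∙0≡0 (suc j) F G zero    = sym 0∙0≡0
shift₁-zipWith _∙_ 0∙0≡0 (suc j) F G (suc n) = shift₁-zipWith _∙_ 0∙0≡0 j F G n

shift₁-D : ∀ (F : ℕ → ℚ) n → shift₁ 1 (λ i → fromℕ (suc i) * F (suc i)) n ≡ fromℕ n * F n
shift₁-D F zero    = sym (*-zeroˡ (F 0))
shift₁-D F (suc n) = refl

indicator : Bool → ℚ
indicator p = if p then 1ℚ else 0ℚ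

δ : ℕ → ℕ → ℚ
δ j x = indicator (x ≡ᵇ j)

sumTo-δ : ∀ n j (G : ℕ → ℚ) → sumTo n (λ x → δ j x * G (n ∸ x)) ≡ shift₁ j G n
sumTo-δ zero    zero    G = *-identityˡ (G 0)
sumTo-δ zero    (suc j) G = *-zeroˡ (G 0)
sumTo-δ (suc n) zero    G = begin
  sumTo (suc n) (λ x → δ 0 x * G (suc n ∸ x))
    ≡⟨ sumTo-suc n (λ x → δ 0 x * G (suc n ∸ x)) ⟩
  1ℚ * G (suc n) + sumTo n (λ x → 0ℚ * G (n ∸ x))
    ≡⟨ cong₂ _+_ (*-identityˡ (G (suc n))) (sumTo-zero n (λ x → *-zeroˡ (G (n ∸ x)))) ⟩
  G (suc n) + 0ℚ
    ≡⟨ +-identityʳ (G (suc n)) ⟩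
  G (suc n)
    ∎
  where open ≡-Reasoning
sumTo-δ (suc n) (suc j) G =
  trans (sumTo-suc n (λ x → δ (suc j) x * G (suc n ∸ x)))
        (trans (cong₂ _+_ (*-zeroˡ (G (suc n))) (sumTo-δ n j G)) (+-identityˡ _))

sumTo-scaled-δ : ∀ n j q (G : ℕ → ℚ) {f : ℕ → ℚ} → (∀ x → f x ≡ q * (δ j x * G (n ∸ x))) →
                 sumTo n f ≡ q * shift₁ j G n
sumTo-scaled-δ n j q G f≡ =
  trans (sumTo-cong n f≡) (trans (sym (*-sumTo n q _)) (cong (q *_) (sumTo-δ n j G)))

-- shift i j k l f = uⁱ vʲ wᵏ zˡ · f
shift : ℕ → ℕ → ℕ → ℕ → Series → Series
shift i j k l f a b c m =
  shift₁ i (λ a′ → shift₁ j (λ b′ → shift₁ k (λ c′ → shift₁ l (f a′ b′ c′) m) c) b) a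

infix 4 _≈_
_≈_ : Series → Series → Set
f ≈ g = ∀ a b c m → f a b c m ≡ g a b c m

≈-setoid : Setoid 0ℓ 0ℓ
≈-setoid = record
  { Carrier       = Series
  ; _≈_           = _≈_
  ; isEquivalence = record
    { refl  = λ a b c m → refl
    ; sym   = λ f≈g a b c m → sym (f≈g a b c m)
    ; trans = λ f≈g g≈h a b c m → trans (f≈g a b c m) (g≈h a b c m)
    }
  }

module ≈-Reasoning = SetoidReasoning ≈-setoid

open Setoid ≈-setoid public using () renaming (refl to ≈-refl; trans to ≈-trans)

⊕-cong : ∀ {f f′ g g′} → f ≈ f′ → g ≈ g′ → f ⊕ g ≈ f′ ⊕ g′
⊕-cong f≈f′ g≈g′ a b c m = cong₂ _+_ (f≈f′ a b c m) (g≈g′ a b c m)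

⊖-cong : ∀ {f f′ g g′} → f ≈ f′ → g ≈ g′ → f ⊖ g ≈ f′ ⊖ g′
⊖-cong f≈f′ g≈g′ a b c m = cong₂ _-_ (f≈f′ a b c m) (g≈g′ a b c m)

shift-cong : ∀ i j k l {f g} → f ≈ g → shift i j k l f ≈ shift i j k l g
shift-cong i j k l f≈g a b c m =
  shift₁-cong i (λ a′ → shift₁-cong j (λ b′ → shift₁-cong k (λ c′ → shift₁-cong l (f≈g a′ b′ c′) m) c) b) a

shift-zipWith : ∀ (_∙_ : ℚ → ℚ → ℚ) → 0ℚ ∙ 0ℚ ≡ 0ℚ → ∀ i j k l f g →
  shift i j k l (λ a b c m → f a b c m ∙ g a b c m)
  ≈ (λ a b c m → shift i j k l f a b c m ∙ shift i j k l g a b c m)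
shift-zipWith _∙_ 0∙0≡0 i j k l f g a b c m =
  trans (shift₁-cong i (λ a′ →
          trans (shift₁-cong j (λ b′ →
                  trans (shift₁-cong k (λ c′ → zip l (f a′ b′ c′) (g a′ b′ c′) m) c)
                        (zip k _ _ c)) b)
                (zip j _ _ b)) a)
        (zip i _ _ a)
  where zip = shift₁-zipWith _∙_ 0∙0≡0

shift-⊕ : ∀ i j k l f g → shift i j k l (f ⊕ g) ≈ shift i j k l f ⊕ shift i j k l g
shift-⊕ = shift-zipWith _+_ refl

shift-⊖ : ∀ i j k l f g → shift i j k l (f ⊖ g) ≈ shift i j k l f ⊖ shift i j k l g
shift-⊖ = shift-zipWith _-_ refl

shift-shift : ∀ i j k l i′ j′ k′ l′ f →
  shift i j k l (shift i′ j′ k′ l′ f) ≈ shift (i ℕ.+ i′) (j ℕ.+ j′) (k ℕ.+ k′) (l ℕ.+ l′) f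
shift-shift (suc i) j k l i′ j′ k′ l′ f zero    b c m = refl
shift-shift (suc i) j k l i′ j′ k′ l′ f (suc a) b c m = shift-shift i j k l i′ j′ k′ l′ f a b c m
shift-shift zero (suc j) k l i′ j′ k′ l′ f a zero    c m = sym (shift₁-zero i′ (λ _ → refl) a)
shift-shift zero (suc j) k l i′ j′ k′ l′ f a (suc b) c m = shift-shift zero j k l i′ j′ k′ l′ f a b c m
shift-shift zero zero (suc k) l i′ j′ k′ l′ f a b zero    m =
  sym (shift₁-zero i′ (λ _ → shift₁-zero j′ (λ _ → refl) b) a)
shift-shift zero zero (suc k) l i′ j′ k′ l′ f a b (suc c) m = shift-shift zero zero k l i′ j′ k′ l′ f a b c m
shift-shift zero zero zero (suc l) i′ j′ k′ l′ f a b c zero    =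
  sym (shift₁-zero i′ (λ _ → shift₁-zero j′ (λ _ → shift₁-zero k′ (λ _ → refl) c) b) a)
shift-shift zero zero zero (suc l) i′ j′ k′ l′ f a b c (suc m) =
  shift-shift zero zero zero l i′ j′ k′ l′ f a b c m
shift-shift zero zero zero zero    i′ j′ k′ l′ f a b c m       = refl

shift-monomial : ∀ i j k l i′ j′ k′ l′ →
  shift i j k l (monomial i′ j′ k′ l′) ≈ monomial (i ℕ.+ i′) (j ℕ.+ j′) (k ℕ.+ k′) (l ℕ.+ l′)
shift-monomial (suc i) j k l i′ j′ k′ l′ zero    b c m = refl
shift-monomial (suc i) j k l i′ j′ k′ l′ (suc a) b c m = shift-monomial i j k l i′ j′ k′ l′ a b c m
shift-monomial zero (suc j) k l i′ j′ k′ l′ a zero    c m = cong indicator (sym (∧-zeroʳ (a ≡ᵇ i′)))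
shift-monomial zero (suc j) k l i′ j′ k′ l′ a (suc b) c m = shift-monomial zero j k l i′ j′ k′ l′ a b c m
shift-monomial zero zero (suc k) l i′ j′ k′ l′ a b zero    m =
  cong indicator (sym (trans (cong ((a ≡ᵇ i′) ∧_) (∧-zeroʳ (b ≡ᵇ j′))) (∧-zeroʳ (a ≡ᵇ i′))))
shift-monomial zero zero (suc k) l i′ j′ k′ l′ a b (suc c) m = shift-monomial zero zero k l i′ j′ k′ l′ a b c m
shift-monomial zero zero zero (suc l) i′ j′ k′ l′ a b c zero    =
  cong indicator (sym (trans (cong (λ p → (a ≡ᵇ i′) ∧ ((b ≡ᵇ j′) ∧ p)) (∧-zeroʳ (c ≡ᵇ k′)))
                      (trans (cong ((a ≡ᵇ i′) ∧_) (∧-zeroʳ (b ≡ᵇ j′))) (∧-zeroʳ (a ≡ᵇ i′)))))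
shift-monomial zero zero zero (suc l) i′ j′ k′ l′ a b c (suc m) =
  shift-monomial zero zero zero l i′ j′ k′ l′ a b c m
shift-monomial zero zero zero zero    i′ j′ k′ l′ a b c m       = refl

D-cong : ∀ {f g} → f ≈ g → D f ≈ D g
D-cong f≈g a b c m = cong (fromℕ (suc m) *_) (f≈g a b c (suc m))

D-⊖ : ∀ f g → D (f ⊖ g) ≈ D f ⊖ D g
D-⊖ f g a b c m = x[y-z]≈xy-xz (fromℕ (suc m)) (f a b c (suc m)) (g a b c (suc m))

D-shift : ∀ i j k f → D (shift i j k 0 f) ≈ shift i j k 0 (D f)
D-shift i j k f a b c m = sym
  (trans (shift₁-cong i (λ a′ → trans (shift₁-cong j (λ b′ → pull k _ c) b) (pull j _ b)) a) (pull i _ a))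
  where pull = shift₁-map (fromℕ (suc m) *_) (*-zeroʳ (fromℕ (suc m)))

D-shiftᶻ : ∀ f → D (shift 0 0 0 1 f) ≈ f ⊕ shift 0 0 0 1 (D f)
D-shiftᶻ f a b c m = begin
  fromℕ (suc m) * f a b c m               ≡⟨ cong (_* f a b c m) (fromℕ-suc m) ⟩
  (1ℚ + fromℕ m) * f a b c m              ≡⟨ *-distribʳ-+ (f a b c m) 1ℚ (fromℕ m) ⟩
  1ℚ * f a b c m + fromℕ m * f a b c m    ≡⟨ cong₂ _+_ (*-identityˡ (f a b c m)) (sym (shift₁-D (f a b c) m)) ⟩
  f a b c m + shift₁ 1 (D f a b c) m      ∎
  where open ≡-Reasoning

⊛-congˡ : ∀ {f f′} g → f ≈ f′ → f ⊛ g ≈ f′ ⊛ g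
⊛-congˡ g f≈f′ a b c m =
  sumTo-cong a λ a₁ → sumTo-cong b λ b₁ → sumTo-cong c λ c₁ → sumTo-cong m λ m₁ →
    cong (_* g (a ∸ a₁) (b ∸ b₁) (c ∸ c₁) (m ∸ m₁)) (f≈f′ a₁ b₁ c₁ m₁)

⊛-distribʳ-⊖ : ∀ f f′ g → (f ⊖ f′) ⊛ g ≈ f ⊛ g ⊖ f′ ⊛ g
⊛-distribʳ-⊖ f f′ g a b c m = sym
  (trans (sumTo-minus a _ _) (sumTo-cong a λ a₁ →
   trans (sumTo-minus b _ _) (sumTo-cong b λ b₁ →
   trans (sumTo-minus c _ _) (sumTo-cong c λ c₁ →
   trans (sumTo-minus m _ _) (sumTo-cong m λ m₁ →
     sym ([y-z]x≈yx-zx (g (a ∸ a₁) (b ∸ b₁) (c ∸ c₁) (m ∸ m₁)) (f a₁ b₁ c₁ m₁) (f′ a₁ b₁ c₁ m₁)))))))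

indicator-∧ : ∀ p q → indicator (p ∧ q) ≡ indicator p * indicator q
indicator-∧ true  q = sym (*-identityˡ (indicator q))
indicator-∧ false q = sym (*-zeroˡ (indicator q))

monomial-δ : ∀ i j k l a b c m → monomial i j k l a b c m ≡ δ i a * (δ j b * (δ k c * δ l m))
monomial-δ i j k l a b c m =
  trans (indicator-∧ (a ≡ᵇ i) _) (cong (δ i a *_)
    (trans (indicator-∧ (b ≡ᵇ j) _) (cong (δ j b *_) (indicator-∧ (c ≡ᵇ k) _))))

monomial-⊛ : ∀ i j k l g → monomial i j k l ⊛ g ≈ shift i j k l g
monomial-⊛ i j k l g a b c m =
  -- the monomial is δ i a₁ · δ j b₁ · δ k c₁ · δ l m₁, and each δ collapses one of the four sums
  trans (sumTo-scaled-δ a i 1ℚ (λ a′ → shift 0 j k l g a′ b c m) λ a₁ →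
   trans (sumTo-scaled-δ b j (δ i a₁) (λ b′ → shift 0 0 k l g (a ∸ a₁) b′ c m) λ b₁ →
    trans (sumTo-scaled-δ c k (δ i a₁ * δ j b₁) (λ c′ → shift 0 0 0 l g (a ∸ a₁) (b ∸ b₁) c′ m) λ c₁ →
     trans (sumTo-scaled-δ m l (δ i a₁ * δ j b₁ * δ k c₁) (g (a ∸ a₁) (b ∸ b₁) (c ∸ c₁)) λ m₁ →
       trans (cong (_* g (a ∸ a₁) (b ∸ b₁) (c ∸ c₁) (m ∸ m₁)) (monomial-δ i j k l a₁ b₁ c₁ m₁))
             (regroup (δ i a₁) (δ j b₁) (δ k c₁) (δ l m₁) (g (a ∸ a₁) (b ∸ b₁) (c ∸ c₁) (m ∸ m₁))))
     (*-assoc (δ i a₁ * δ j b₁) (δ k c₁) (shift₁ l (g (a ∸ a₁) (b ∸ b₁) (c ∸ c₁)) m)))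
    (*-assoc (δ i a₁) (δ j b₁) (shift 0 0 k l g (a ∸ a₁) (b ∸ b₁) c m)))
   (sym (*-identityˡ (δ i a₁ * shift 0 j k l g (a ∸ a₁) b c m))))
  (*-identityˡ (shift i j k l g a b c m))
  where
  regroup : ∀ x y z w v → x * (y * (z * w)) * v ≡ x * y * z * (w * v)
  regroup = solve 5 (λ x y z w v → x :* (y :* (z :* w)) :* v := x :* y :* z :* (w :* v)) refl

monomial-⊛-monomial : ∀ i j k l i′ j′ k′ l′ →
  monomial i j k l ⊛ monomial i′ j′ k′ l′ ≈ monomial (i ℕ.+ i′) (j ℕ.+ j′) (k ℕ.+ k′) (l ℕ.+ l′)
monomial-⊛-monomial i j k l i′ j′ k′ l′ a b c m =
  trans (monomial-⊛ i j k l (monomial i′ j′ k′ l′) a b c m) (shift-monomial i j k l i′ j′ k′ l′ a b c m)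

monomial-⊖-⊛ : ∀ i j k l i′ j′ k′ l′ g →
  (monomial i j k l ⊖ monomial i′ j′ k′ l′) ⊛ g ≈ shift i j k l g ⊖ shift i′ j′ k′ l′ g
monomial-⊖-⊛ i j k l i′ j′ k′ l′ g =
  ≈-trans (⊛-distribʳ-⊖ (monomial i j k l) (monomial i′ j′ k′ l′) g)
          (⊖-cong (monomial-⊛ i j k l g) (monomial-⊛ i′ j′ k′ l′ g))

monomial-⊛-[1-z²] : ∀ i j k l →
  monomial i j k l ⊛ (𝟙 ⊖ 𝕫 ⊛ 𝕫) ≈ shift i j k l 𝟙 ⊖ shift i j k l (monomial 0 0 0 2)
monomial-⊛-[1-z²] i j k l = ≈-trans (monomial-⊛ i j k l (𝟙 ⊖ 𝕫 ⊛ 𝕫))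
  (≈-trans (shift-cong i j k l (⊖-cong (≈-refl {𝟙}) (monomial-⊛-monomial 0 0 0 1 0 0 0 1)))
           (shift-⊖ i j k l 𝟙 (monomial 0 0 0 2)))

z[1-z²]-⊛ : ∀ g → 𝕫 ⊛ (𝟙 ⊖ 𝕫 ⊛ 𝕫) ⊛ g ≈ shift 0 0 0 1 g ⊖ shift 0 0 0 3 g
z[1-z²]-⊛ g = ≈-trans (⊛-congˡ g z[1-z²]) (monomial-⊖-⊛ 0 0 0 1 0 0 0 3 g)
  where
  z[1-z²] : 𝕫 ⊛ (𝟙 ⊖ 𝕫 ⊛ 𝕫) ≈ monomial 0 0 0 1 ⊖ monomial 0 0 0 3
  z[1-z²] = ≈-trans (monomial-⊛-[1-z²] 0 0 0 1)
    (⊖-cong (shift-monomial 0 0 0 1 0 0 0 0) (shift-monomial 0 0 0 1 0 0 0 2))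

[1-u][1-z²]-vz²-⊛ : ∀ g → ((𝟙 ⊖ 𝕦) ⊛ (𝟙 ⊖ 𝕫 ⊛ 𝕫) ⊖ 𝕧 ⊛ 𝕫 ⊛ 𝕫) ⊛ g
                          ≈ ((g ⊖ shift 0 0 0 2 g) ⊖ (shift 1 0 0 0 g ⊖ shift 1 0 0 2 g)) ⊖ shift 0 1 0 2 g
[1-u][1-z²]-vz²-⊛ g = begin
  ((𝟙 ⊖ 𝕦) ⊛ (𝟙 ⊖ 𝕫 ⊛ 𝕫) ⊖ 𝕧 ⊛ 𝕫 ⊛ 𝕫) ⊛ g
    ≈⟨ ⊛-distribʳ-⊖ ((𝟙 ⊖ 𝕦) ⊛ (𝟙 ⊖ 𝕫 ⊛ 𝕫)) (𝕧 ⊛ 𝕫 ⊛ 𝕫) g ⟩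
  (𝟙 ⊖ 𝕦) ⊛ (𝟙 ⊖ 𝕫 ⊛ 𝕫) ⊛ g ⊖ 𝕧 ⊛ 𝕫 ⊛ 𝕫 ⊛ g
    ≈⟨ ⊖-cong (⊛-congˡ g [1-u][1-z²]) (⊛-congˡ g vz²) ⟩
  ((monomial 0 0 0 0 ⊖ monomial 0 0 0 2) ⊖ (monomial 1 0 0 0 ⊖ monomial 1 0 0 2)) ⊛ g ⊖ monomial 0 1 0 2 ⊛ g
    ≈⟨ ⊖-cong (⊛-distribʳ-⊖ (monomial 0 0 0 0 ⊖ monomial 0 0 0 2) (monomial 1 0 0 0 ⊖ monomial 1 0 0 2) g)
              (monomial-⊛ 0 1 0 2 g) ⟩
  ((monomial 0 0 0 0 ⊖ monomial 0 0 0 2) ⊛ g ⊖ (monomial 1 0 0 0 ⊖ monomial 1 0 0 2) ⊛ g) ⊖ shift 0 1 0 2 g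
    ≈⟨ ⊖-cong (⊖-cong (monomial-⊖-⊛ 0 0 0 0 0 0 0 2 g) (monomial-⊖-⊛ 1 0 0 0 1 0 0 2 g)) ≈-refl ⟩
  ((g ⊖ shift 0 0 0 2 g) ⊖ (shift 1 0 0 0 g ⊖ shift 1 0 0 2 g)) ⊖ shift 0 1 0 2 g
    ∎
  where
  open ≈-Reasoning
  [1-u][1-z²] : (𝟙 ⊖ 𝕦) ⊛ (𝟙 ⊖ 𝕫 ⊛ 𝕫)
                ≈ (monomial 0 0 0 0 ⊖ monomial 0 0 0 2) ⊖ (monomial 1 0 0 0 ⊖ monomial 1 0 0 2)
  [1-u][1-z²] = ≈-trans (⊛-distribʳ-⊖ 𝟙 𝕦 (𝟙 ⊖ 𝕫 ⊛ 𝕫)) (⊖-cong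
    (≈-trans (monomial-⊛-[1-z²] 0 0 0 0) (⊖-cong (shift-monomial 0 0 0 0 0 0 0 0) (shift-monomial 0 0 0 0 0 0 0 2)))
    (≈-trans (monomial-⊛-[1-z²] 1 0 0 0) (⊖-cong (shift-monomial 1 0 0 0 0 0 0 0) (shift-monomial 1 0 0 0 0 0 0 2))))
  vz² : 𝕧 ⊛ 𝕫 ⊛ 𝕫 ≈ monomial 0 1 0 2
  vz² = ≈-trans (⊛-congˡ 𝕫 (monomial-⊛-monomial 0 1 0 0 0 0 0 1)) (monomial-⊛-monomial 0 1 0 1 0 0 0 1)

[uv-w]z-⊛ : ∀ g → (𝕦 ⊛ 𝕧 ⊖ 𝕨) ⊛ 𝕫 ⊛ g ≈ shift 1 1 0 1 g ⊖ shift 0 0 1 1 g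
[uv-w]z-⊛ g = ≈-trans (⊛-congˡ g [uv-w]z) (monomial-⊖-⊛ 1 1 0 1 0 0 1 1 g)
  where
  [uv-w]z : (𝕦 ⊛ 𝕧 ⊖ 𝕨) ⊛ 𝕫 ≈ monomial 1 1 0 1 ⊖ monomial 0 0 1 1
  [uv-w]z = ≈-trans (⊛-distribʳ-⊖ (𝕦 ⊛ 𝕧) 𝕨 𝕫)
    (⊖-cong (≈-trans (⊛-congˡ 𝕫 (monomial-⊛-monomial 1 0 0 0 0 1 0 0)) (monomial-⊛-monomial 1 1 0 0 0 0 0 1))
            (monomial-⊛-monomial 0 0 1 0 0 0 0 1))

ODE-LHS-expand : ∀ f → ODE-LHS f ≈
    (shift 0 0 0 1 (D (D f)) ⊖ shift 0 0 0 3 (D (D f)))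
  ⊕ (((D f ⊖ shift 0 0 0 2 (D f)) ⊖ (shift 1 0 0 0 (D f) ⊖ shift 1 0 0 2 (D f))) ⊖ shift 0 1 0 2 (D f))
  ⊕ (shift 1 1 0 1 f ⊖ shift 0 0 1 1 f)
ODE-LHS-expand f = ⊕-cong (⊕-cong (z[1-z²]-⊛ (D (D f))) ([1-u][1-z²]-vz²-⊛ (D f))) ([uv-w]z-⊛ f)

ODE-LHS-factor : ∀ f g → g ≈ shift 0 0 0 1 (D f) ⊖ shift 1 0 0 0 f →
  ODE-LHS f ≈ (D g ⊖ shift 0 0 0 2 (D g)) ⊖ (shift 0 0 1 1 f ⊕ shift 0 1 0 1 g)
ODE-LHS-factor f g g≈zf′-uf a b c m =
  trans (ODE-LHS-expand f a b c m)
  (trans (regroup z¹f″ z³f″ f′ z²f′ uf′ uz²f′ vz²f′ uvzf wzf)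
         (sym (cong₂ _-_ (cong₂ _-_ (Dg a b c m) (z²Dg a b c m)) (cong (wzf +_) (vzg a b c m)))))
  where
  open ≈-Reasoning
  z¹f″ = shift 0 0 0 1 (D (D f)) a b c m
  z³f″ = shift 0 0 0 3 (D (D f)) a b c m
  f′ = D f a b c m
  z²f′ = shift 0 0 0 2 (D f) a b c m
  uf′ = shift 1 0 0 0 (D f) a b c m
  uz²f′ = shift 1 0 0 2 (D f) a b c m
  vz²f′ = shift 0 1 0 2 (D f) a b c m
  uvzf = shift 1 1 0 1 f a b c m
  wzf = shift 0 0 1 1 f a b c m
  regroup : ∀ A₁ A₃ B₀ B₂ Bᵤ Bᵤ₂ Bᵥ₂ Cᵤᵥ C𝓌 →
    (A₁ - A₃) + (((B₀ - B₂) - (Bᵤ - Bᵤ₂)) - Bᵥ₂) + (Cᵤᵥ - C𝓌)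
    ≡ (((B₀ + A₁) - Bᵤ) - ((B₂ + A₃) - Bᵤ₂)) - (C𝓌 + (Bᵥ₂ - Cᵤᵥ))
  regroup = solve 9 (λ A₁ A₃ B₀ B₂ Bᵤ Bᵤ₂ Bᵥ₂ Cᵤᵥ C𝓌 →
    (A₁ :- A₃) :+ (((B₀ :- B₂) :- (Bᵤ :- Bᵤ₂)) :- Bᵥ₂) :+ (Cᵤᵥ :- C𝓌)
    := (((B₀ :+ A₁) :- Bᵤ) :- ((B₂ :+ A₃) :- Bᵤ₂)) :- (C𝓌 :+ (Bᵥ₂ :- Cᵤᵥ))) refl
  Dg : D g ≈ (D f ⊕ shift 0 0 0 1 (D (D f))) ⊖ shift 1 0 0 0 (D f)
  Dg = begin
    D g                                             ≈⟨ D-cong g≈zf′-uf ⟩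
    D (shift 0 0 0 1 (D f) ⊖ shift 1 0 0 0 f)       ≈⟨ D-⊖ (shift 0 0 0 1 (D f)) (shift 1 0 0 0 f) ⟩
    D (shift 0 0 0 1 (D f)) ⊖ D (shift 1 0 0 0 f)   ≈⟨ ⊖-cong (D-shiftᶻ (D f)) (D-shift 1 0 0 f) ⟩
    (D f ⊕ shift 0 0 0 1 (D (D f))) ⊖ shift 1 0 0 0 (D f) ∎
  z²Dg : shift 0 0 0 2 (D g) ≈ (shift 0 0 0 2 (D f) ⊕ shift 0 0 0 3 (D (D f))) ⊖ shift 1 0 0 2 (D f)
  z²Dg = begin
    shift 0 0 0 2 (D g)
      ≈⟨ shift-cong 0 0 0 2 Dg ⟩
    shift 0 0 0 2 ((D f ⊕ shift 0 0 0 1 (D (D f))) ⊖ shift 1 0 0 0 (D f))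
      ≈⟨ shift-⊖ 0 0 0 2 (D f ⊕ shift 0 0 0 1 (D (D f))) (shift 1 0 0 0 (D f)) ⟩
    shift 0 0 0 2 (D f ⊕ shift 0 0 0 1 (D (D f))) ⊖ shift 0 0 0 2 (shift 1 0 0 0 (D f))
      ≈⟨ ⊖-cong (shift-⊕ 0 0 0 2 (D f) (shift 0 0 0 1 (D (D f)))) (shift-shift 0 0 0 2 1 0 0 0 (D f)) ⟩
    (shift 0 0 0 2 (D f) ⊕ shift 0 0 0 2 (shift 0 0 0 1 (D (D f)))) ⊖ shift 1 0 0 2 (D f)
      ≈⟨ ⊖-cong (⊕-cong (≈-refl {shift 0 0 0 2 (D f)}) (shift-shift 0 0 0 2 0 0 0 1 (D (D f))))
                (≈-refl {shift 1 0 0 2 (D f)}) ⟩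
    (shift 0 0 0 2 (D f) ⊕ shift 0 0 0 3 (D (D f))) ⊖ shift 1 0 0 2 (D f)
      ∎
  vzg : shift 0 1 0 1 g ≈ shift 0 1 0 2 (D f) ⊖ shift 1 1 0 1 f
  vzg = ≈-trans (shift-cong 0 1 0 1 g≈zf′-uf)
    (≈-trans (shift-⊖ 0 1 0 1 (shift 0 0 0 1 (D f)) (shift 1 0 0 0 f))
             (⊖-cong (shift-shift 0 1 0 1 0 0 0 1 (D f)) (shift-shift 0 1 0 1 1 0 0 0 f)))

data EvenOrOdd : ℕ → Set where
  even : ∀ j → EvenOrOdd (j ℕ.* 2)
  odd  : ∀ j → EvenOrOdd (suc (j ℕ.* 2))

evenOrOdd : ∀ m → EvenOrOdd m
evenOrOdd zero = even 0
evenOrOdd (suc m) with evenOrOdd m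
... | even j = odd j
... | odd  j = even (suc j)

truncSum : List ℕ → ℕ → ℚ
truncSum ks b = sumL (map (term ks) (decOdd (length ks) b))

oddCoef : List ℕ → ℕ → ℚ
oddCoef []       j = 0ℚ
oddCoef (k ∷ ks) j = invOddPow j k * truncSum ks j

truncSum-∷ : ∀ k ks b → truncSum (k ∷ ks) (suc b) ≡ sumTo b (oddCoef (k ∷ ks))
truncSum-∷ k ks b = begin
  sumL (map (term (k ∷ ks)) (concatMap (λ j → map (j ∷_) (decOdd (length ks) j)) (upTo (suc b))))
    ≡⟨ sumL-map-prefixed (term (k ∷ ks)) (λ j → j) (decOdd (length ks)) (upTo (suc b)) ⟩
  sumL (map (λ j → sumL (map (λ js → invOddPow j k * term ks js) (decOdd (length ks) j))) (upTo (suc b)))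
    ≡⟨ sumL-map-cong (λ j → sym (*-sumL-map (invOddPow j k) (term ks) (decOdd (length ks) j))) (upTo (suc b)) ⟩
  sumL (map (oddCoef (k ∷ ks)) (upTo (suc b)))
    ≡⟨ sumL-map-upTo b (oddCoef (k ∷ ks)) ⟩
  sumTo b (oddCoef (k ∷ ks))
    ∎
  where open ≡-Reasoning

truncSum-suc : ∀ ks b → truncSum ks (suc b) ≡ truncSum ks b + oddCoef ks b
truncSum-suc []       b       = sym (+-identityʳ (truncSum [] b))
truncSum-suc (k ∷ ks) zero    = trans (truncSum-∷ k ks 0) (sym (+-identityˡ _))
truncSum-suc (k ∷ ks) (suc b) =
  trans (truncSum-∷ k ks (suc b)) (cong (_+ oddCoef (k ∷ ks) (suc b)) (sym (truncSum-∷ k ks b)))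

sumL-headIs : ∀ ks j →
  sumL (map (term ks) (filterᵇ (headIs j) (decOdd (length ks) (suc j)))) ≡ oddCoef ks j
sumL-headIs []       j = refl
sumL-headIs (k ∷ ks) j = begin
  sumL (map (term (k ∷ ks)) (filterᵇ (headIs j) (decOdd (suc n) (suc j))))
    ≡⟨ sumL-map-filterᵇ (term (k ∷ ks)) (headIs j) (decOdd (suc n) (suc j)) ⟩
  sumL (map (λ js → if headIs j js then term (k ∷ ks) js else 0ℚ) (decOdd (suc n) (suc j)))
    ≡⟨ sumL-map-prefixed _ (λ i → i) (decOdd n) (upTo (suc j)) ⟩
  sumL (map (λ i → sumL (map (λ js → if i ≡ᵇ j then invOddPow i k * term ks js else 0ℚ) (decOdd n i)))
            (upTo (suc j)))
    ≡⟨ sumL-map-cong (λ i → trans (sumL-map-if (i ≡ᵇ j) _ (decOdd n i))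
                                  (cong (λ x → if i ≡ᵇ j then x else 0ℚ)
                                        (sym (*-sumL-map (invOddPow i k) (term ks) (decOdd n i)))))
                     (upTo (suc j)) ⟩
  sumL (map (λ i → if i ≡ᵇ j then oddCoef (k ∷ ks) i else 0ℚ) (upTo (suc j)))
    ≡⟨ sumL-map-upTo j _ ⟩
  sumTo j (λ i → if i ≡ᵇ j then oddCoef (k ∷ ks) i else 0ℚ)
    ≡⟨ sumTo-at-last j (oddCoef (k ∷ ks)) ⟩
  oddCoef (k ∷ ks) j
    ∎
  where
  open ≡-Reasoning
  n = length ks

Lcoef-odd : ∀ ks j → Lcoef ks (suc (j ℕ.* 2)) ≡ oddCoef ks j
Lcoef-odd ks j = trans
  (cong₂ (λ r h → if r ≡ᵇ 1 then sumL (map (term ks) (filterᵇ (headIs h) (decOdd (length ks) (suc h)))) else 0ℚ)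
         ([m+kn]%n≡m%n 1 j 2)
         (trans (+-distrib-/-∣ʳ 1 {d = 2} (divides-refl j)) (m*n/n≡m j 2)))
  (sumL-headIs ks j)

Lcoef-even : ∀ ks j → Lcoef ks (j ℕ.* 2) ≡ 0ℚ
Lcoef-even ks j =
  cong (λ r → if r ≡ᵇ 1 then sumL (map (term ks) (filterᵇ (headIs h) (decOdd (length ks) (suc h)))) else 0ℚ)
       (m*n%n≡0 j 2)
  where h = j ℕ.* 2 ℕ./ 2

Lcoef-[] : ∀ m → Lcoef [] m ≡ 0ℚ
Lcoef-[] m = if-eta (isOdd m)

fromℕ-*-invOddPow : ∀ j k x → fromℕ (suc (j ℕ.* 2)) * (invOddPow j (suc k) * x) ≡ invOddPow j k * x
fromℕ-*-invOddPow j k x = begin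
  fromℕ (suc n) * (r * invOddPow j k * x)   ≡⟨ cong (fromℕ (suc n) *_) (*-assoc r (invOddPow j k) x) ⟩
  fromℕ (suc n) * (r * (invOddPow j k * x)) ≡⟨ *-assoc (fromℕ (suc n)) r (invOddPow j k * x) ⟨
  fromℕ (suc n) * r * (invOddPow j k * x)   ≡⟨ cong (_* (invOddPow j k * x)) (fromℕ-*-inverse n) ⟩
  1ℚ * (invOddPow j k * x)                  ≡⟨ *-identityˡ (invOddPow j k * x) ⟩
  invOddPow j k * x                         ∎
  where
  open ≡-Reasoning
  n = j ℕ.* 2
  r = ℤ.+ 1 / suc n

incrHead : List ℕ → List ℕ
incrHead []       = []
incrHead (k ∷ ks) = suc k ∷ ks

Lcoef-incrHead : ∀ ks m → fromℕ m * Lcoef (incrHead ks) m ≡ Lcoef ks m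
Lcoef-incrHead [] m = trans (cong (fromℕ m *_) (Lcoef-[] m)) (trans (*-zeroʳ (fromℕ m)) (sym (Lcoef-[] m)))
Lcoef-incrHead (k ∷ ks) m with evenOrOdd m
... | even j = trans (cong (fromℕ (j ℕ.* 2) *_) (Lcoef-even (suc k ∷ ks) j))
                     (trans (*-zeroʳ (fromℕ (j ℕ.* 2))) (sym (Lcoef-even (k ∷ ks) j)))
... | odd j  = trans (cong (fromℕ (suc (j ℕ.* 2)) *_) (Lcoef-odd (suc k ∷ ks) j))
                     (trans (fromℕ-*-invOddPow j k (truncSum ks j)) (sym (Lcoef-odd (k ∷ ks) j)))

-- (1 − z²) 𝓛′_{(1, 𝐤)} = z 𝓛_𝐤, compared at z^{m + 1}
Lcoef-1∷-recurrence : ∀ ks m →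
  fromℕ (suc (suc m)) * Lcoef (1 ∷ ks) (suc (suc m)) - fromℕ m * Lcoef (1 ∷ ks) m ≡ Lcoef ks m
Lcoef-1∷-recurrence ks m with evenOrOdd m
... | even j = begin
  fromℕ (suc (suc (j ℕ.* 2))) * Lcoef (1 ∷ ks) (suc j ℕ.* 2) - fromℕ (j ℕ.* 2) * Lcoef (1 ∷ ks) (j ℕ.* 2)
    ≡⟨ cong₂ (λ x y → fromℕ (suc (suc (j ℕ.* 2))) * x - fromℕ (j ℕ.* 2) * y)
             (Lcoef-even (1 ∷ ks) (suc j)) (Lcoef-even (1 ∷ ks) j) ⟩
  fromℕ (suc (suc (j ℕ.* 2))) * 0ℚ - fromℕ (j ℕ.* 2) * 0ℚ
    ≡⟨ cong₂ _-_ (*-zeroʳ (fromℕ (suc (suc (j ℕ.* 2))))) (*-zeroʳ (fromℕ (j ℕ.* 2))) ⟩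
  0ℚ
    ≡⟨ Lcoef-even ks j ⟨
  Lcoef ks (j ℕ.* 2)
    ∎
  where open ≡-Reasoning
... | odd j = begin
  fromℕ (suc (suc j ℕ.* 2)) * Lcoef (1 ∷ ks) (suc (suc j ℕ.* 2))
    - fromℕ (suc (j ℕ.* 2)) * Lcoef (1 ∷ ks) (suc (j ℕ.* 2))
    ≡⟨ cong₂ (λ x y → fromℕ (suc (suc j ℕ.* 2)) * x - fromℕ (suc (j ℕ.* 2)) * y)
             (Lcoef-odd (1 ∷ ks) (suc j)) (Lcoef-odd (1 ∷ ks) j) ⟩
  fromℕ (suc (suc j ℕ.* 2)) * oddCoef (1 ∷ ks) (suc j) - fromℕ (suc (j ℕ.* 2)) * oddCoef (1 ∷ ks) j
    ≡⟨ cong₂ _-_ (fromℕ-*-invOddPow (suc j) 0 (truncSum ks (suc j)))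
                 (fromℕ-*-invOddPow j 0 (truncSum ks j)) ⟩
  1ℚ * truncSum ks (suc j) - 1ℚ * truncSum ks j
    ≡⟨ cong₂ _-_ (trans (*-identityˡ _) (truncSum-suc ks j)) (*-identityˡ _) ⟩
  truncSum ks j + oddCoef ks j - truncSum ks j
    ≡⟨ [x+y]-x≡y (truncSum ks j) (oddCoef ks j) ⟩
  oddCoef ks j
    ≡⟨ Lcoef-odd ks j ⟨
  Lcoef ks (suc (j ℕ.* 2))
    ∎
  where open ≡-Reasoning

sumComp : ℕ → ℕ → (List ℕ → ℚ) → ℚ
sumComp k n F = sumL (map F (compositions k n))

atHeight : ℕ → (List ℕ → ℚ) → List ℕ → ℚ
atHeight s F ks = if height ks ≡ᵇ s then F ks else 0ℚ

admissibleOnly : (List ℕ → ℚ) → List ℕ → ℚ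
admissibleOnly F ks = if admissible ks then F ks else 0ℚ

compositions-suc : ∀ k n →
  compositions k (suc n) ≡ concatMap (λ j → map (suc j ∷_) (compositions (k ∸ suc j) n)) (upTo k)
compositions-suc zero    n = refl
compositions-suc (suc k) n = refl

sumComp-cong : ∀ k n {F G : List ℕ → ℚ} → (∀ ks → F ks ≡ G ks) → sumComp k n F ≡ sumComp k n G
sumComp-cong k n F≡G = sumL-map-cong F≡G (compositions k n)

sumComp-zero : ∀ k n {F : List ℕ → ℚ} → (∀ ks → F ks ≡ 0ℚ) → sumComp k n F ≡ 0ℚ
sumComp-zero k n F≡0 = sumL-map-zero F≡0 (compositions k n)

sumComp-head : ∀ k n F →
  sumComp k (suc n) F ≡ sumL (applyUpTo (λ j → sumComp (k ∸ suc j) n (λ ks → F (suc j ∷ ks))) k)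
sumComp-head k n F = begin
  sumL (map F (compositions k (suc n)))
    ≡⟨ cong (sumL ∘ map F) (compositions-suc k n) ⟩
  sumL (map F (concatMap (λ j → map (suc j ∷_) (compositions (k ∸ suc j) n)) (upTo k)))
    ≡⟨ sumL-map-prefixed F suc (λ j → compositions (k ∸ suc j) n) (upTo k) ⟩
  sumL (map (λ j → sumComp (k ∸ suc j) n (λ ks → F (suc j ∷ ks))) (upTo k))
    ≡⟨ cong sumL (List.map-upTo _ k) ⟩
  sumL (applyUpTo (λ j → sumComp (k ∸ suc j) n (λ ks → F (suc j ∷ ks))) k)
    ∎
  where open ≡-Reasoning

sumComp-split : ∀ k n F →
  sumComp (suc k) (suc n) F ≡ sumComp (suc k) (suc n) (admissibleOnly F) + sumComp k n (λ ks → F (1 ∷ ks))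
sumComp-split k n F = begin
  sumComp (suc k) (suc n) F                   ≡⟨ sumComp-head (suc k) n F ⟩
  ones + rest                                 ≡⟨ +-comm ones rest ⟩
  rest + ones                                 ≡⟨ cong (_+ ones) (+-identityˡ rest) ⟨
  0ℚ + rest + ones                            ≡⟨ cong (λ x → x + rest + ones) (sumComp-zero k n (λ _ → refl)) ⟨
  sumComp k n (λ _ → 0ℚ) + rest + ones        ≡⟨ cong (_+ ones) (sumComp-head (suc k) n (admissibleOnly F)) ⟨
  sumComp (suc k) (suc n) (admissibleOnly F) + ones ∎
  where
  open ≡-Reasoning
  ones = sumComp k n (λ ks → F (1 ∷ ks))
  rest = sumL (applyUpTo (λ j → sumComp (k ∸ suc j) n (λ ks → F (suc (suc j) ∷ ks))) k)

sumComp-incrHead : ∀ k n F → sumComp (suc k) (suc n) (admissibleOnly F) ≡ sumComp k (suc n) (F ∘ incrHead)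
sumComp-incrHead k n F = begin
  sumComp (suc k) (suc n) (admissibleOnly F)  ≡⟨ sumComp-head (suc k) n (admissibleOnly F) ⟩
  sumComp k n (λ _ → 0ℚ) + rest               ≡⟨ cong (_+ rest) (sumComp-zero k n (λ _ → refl)) ⟩
  0ℚ + rest                                   ≡⟨ +-identityˡ rest ⟩
  rest                                        ≡⟨ sumComp-head k n (F ∘ incrHead) ⟨
  sumComp k (suc n) (F ∘ incrHead)            ∎
  where
  open ≡-Reasoning
  rest = sumL (applyUpTo (λ j → sumComp (k ∸ suc j) n (λ ks → F (suc (suc j) ∷ ks))) k)

-- An index of depth n and height s has s ≤ n and weight at least n + s.
sumComp-vanish : ∀ k n s {F : List ℕ → ℚ} → (∀ ks → (height ks ≡ᵇ s) ≡ false → F ks ≡ 0ℚ) →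
                 k ℕ.< n ℕ.+ s ⊎ n ℕ.< s → sumComp k n F ≡ 0ℚ
sumComp-vanish zero    zero zero    F-supp (inj₁ ())
sumComp-vanish zero    zero zero    F-supp (inj₂ ())
sumComp-vanish zero    zero (suc s) F-supp _ = cong (_+ 0ℚ) (F-supp [] refl)
sumComp-vanish (suc k) zero s       F-supp _ = refl
sumComp-vanish k (suc n) s {F} F-supp small =
  trans (sumComp-head k n F) (sumL-applyUpTo-zero k _ (by-head s F-supp small))
  where
  by-head : ∀ s → (∀ ks → (height ks ≡ᵇ s) ≡ false → F ks ≡ 0ℚ) →
            k ℕ.< suc n ℕ.+ s ⊎ suc n ℕ.< s →
            ∀ j → j ℕ.< k → sumComp (k ∸ suc j) n (λ ks → F (suc j ∷ ks)) ≡ 0ℚ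
  by-head s F-supp small zero 0<k =
    sumComp-vanish (k ∸ 1) n s (F-supp ∘ (1 ∷_)) (smaller small 0<k)
    where
    smaller : k ℕ.< suc n ℕ.+ s ⊎ suc n ℕ.< s → 0 ℕ.< k → k ∸ 1 ℕ.< n ℕ.+ s ⊎ n ℕ.< s
    smaller (inj₁ k<) (ℕ.s≤s _) = inj₁ (ℕ.≤-pred k<)
    smaller (inj₂ n<) _         = inj₂ (ℕ.<-trans (ℕ.n<1+n n) n<)
  by-head zero    F-supp small (suc j) j<k =
    sumComp-zero (k ∸ suc (suc j)) n (λ ks → F-supp (suc (suc j) ∷ ks) refl)
  by-head (suc s) F-supp small (suc j) j<k =
    sumComp-vanish (k ∸ suc (suc j)) n s (F-supp ∘ (suc (suc j) ∷_)) (smaller small j<k)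
    where
    smaller : k ℕ.< suc n ℕ.+ suc s ⊎ suc n ℕ.< suc s → suc j ℕ.< k →
              k ∸ suc (suc j) ℕ.< n ℕ.+ s ⊎ n ℕ.< s
    smaller (inj₁ k<) (ℕ.s≤s (ℕ.s≤s {n = k′} _)) = inj₁ (ℕ.≤-<-trans (ℕ.m∸n≤m k′ j)
      (ℕ.≤-pred (ℕ.≤-pred (subst (k ℕ.<_) (cong suc (ℕ.+-suc n s)) k<))))
    smaller (inj₂ n<) _ = inj₂ (ℕ.≤-pred n<)

sumComp-depth-zero : ∀ k {F : List ℕ → ℚ} → F [] ≡ 0ℚ → sumComp k 0 F ≡ 0ℚ
sumComp-depth-zero zero    F[]≡0 = cong (_+ 0ℚ) F[]≡0
sumComp-depth-zero (suc k) F[]≡0 = refl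

atHeight-supported : ∀ s F ks → (height ks ≡ᵇ s) ≡ false → atHeight s F ks ≡ 0ℚ
atHeight-supported s F ks ≢s = cong (λ b → if b then F ks else 0ℚ) ≢s

admissibleOnly-supported : ∀ s F ks → (height ks ≡ᵇ s) ≡ false → admissibleOnly (atHeight s F) ks ≡ 0ℚ
admissibleOnly-supported s F ks ≢s =
  trans (cong (λ x → if admissible ks then x else 0ℚ) (atHeight-supported s F ks ≢s)) (if-eta (admissible ks))

admissibleOnly-atHeight-zero : ∀ F ks → admissibleOnly (atHeight 0 F) ks ≡ 0ℚ
admissibleOnly-atHeight-zero F []                 = refl
admissibleOnly-atHeight-zero F (zero ∷ ks)        = refl
admissibleOnly-atHeight-zero F (suc zero ∷ ks)    = refl
admissibleOnly-atHeight-zero F (suc (suc k) ∷ ks) = refl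

sumComp-lowerHead : ∀ k n s m →
  fromℕ m * sumComp (suc (suc k)) (suc n) (admissibleOnly (atHeight (suc s) (λ ks → Lcoef ks m)))
  ≡ sumComp (suc k) (suc n) (admissibleOnly (atHeight (suc s) (λ ks → Lcoef ks m)))
    + sumComp k n (atHeight s (λ ks → Lcoef (1 ∷ ks) m))
sumComp-lowerHead k n s m = begin
  fromℕ m * sumComp (suc (suc k)) (suc n) (admissibleOnly L)
    ≡⟨ *-sumL-map (fromℕ m) (admissibleOnly L) (compositions (suc (suc k)) (suc n)) ⟩
  sumComp (suc (suc k)) (suc n) (λ ks → fromℕ m * admissibleOnly L ks)
    ≡⟨ sumComp-cong (suc (suc k)) (suc n) (λ ks → *-if (fromℕ m) (admissible ks) (L ks)) ⟩
  sumComp (suc (suc k)) (suc n) (admissibleOnly (λ ks → fromℕ m * L ks))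
    ≡⟨ sumComp-incrHead (suc k) n (λ ks → fromℕ m * L ks) ⟩
  sumComp (suc k) (suc n) (λ ks → fromℕ m * L (incrHead ks))
    ≡⟨ sumComp-cong (suc k) (suc n) lower ⟩
  sumComp (suc k) (suc n) H
    ≡⟨ sumComp-split k n H ⟩
  sumComp (suc k) (suc n) (admissibleOnly H) + sumComp k n (λ ks → H (1 ∷ ks))
    ≡⟨ cong (_+ sumComp k n (λ ks → H (1 ∷ ks))) (sumComp-cong (suc k) (suc n) admissible-H) ⟩
  sumComp (suc k) (suc n) (admissibleOnly L) + sumComp k n (atHeight s (λ ks → Lcoef (1 ∷ ks) m))
    ∎
  where
  open ≡-Reasoning
  L = atHeight (suc s) (λ ks → Lcoef ks m)
  H : List ℕ → ℚ
  H ks = if height (incrHead ks) ≡ᵇ suc s then Lcoef ks m else 0ℚ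
  lower : ∀ ks → fromℕ m * L (incrHead ks) ≡ H ks
  lower ks = trans (*-if (fromℕ m) _ (Lcoef (incrHead ks) m))
                   (cong (λ x → if height (incrHead ks) ≡ᵇ suc s then x else 0ℚ) (Lcoef-incrHead ks m))
  -- raising a first entry k ≥ 2 does not change the height
  admissible-H : ∀ ks → admissibleOnly H ks ≡ admissibleOnly L ks
  admissible-H []                 = refl
  admissible-H (zero ∷ ks)        = refl
  admissible-H (suc zero ∷ ks)    = refl
  admissible-H (suc (suc k) ∷ ks) = refl

sumComp-Lcoef-1∷-recurrence : ∀ k n s m →
  fromℕ (suc (suc m)) * sumComp k n (atHeight s (λ ks → Lcoef (1 ∷ ks) (suc (suc m))))
  - fromℕ m * sumComp k n (atHeight s (λ ks → Lcoef (1 ∷ ks) m))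
  ≡ sumComp k n (atHeight s (λ ks → Lcoef ks m))
sumComp-Lcoef-1∷-recurrence k n s m = begin
  fromℕ (suc (suc m)) * sumComp k n L₂ - fromℕ m * sumComp k n L₀
    ≡⟨ cong₂ _-_ (*-sumL-map (fromℕ (suc (suc m))) L₂ (compositions k n))
                 (*-sumL-map (fromℕ m) L₀ (compositions k n)) ⟩
  sumComp k n (λ ks → fromℕ (suc (suc m)) * L₂ ks) - sumComp k n (λ ks → fromℕ m * L₀ ks)
    ≡⟨ sumL-map-minus (λ ks → fromℕ (suc (suc m)) * L₂ ks) (λ ks → fromℕ m * L₀ ks) (compositions k n) ⟩
  sumComp k n (λ ks → fromℕ (suc (suc m)) * L₂ ks - fromℕ m * L₀ ks)
    ≡⟨ sumComp-cong k n pointwise ⟩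
  sumComp k n (atHeight s (λ ks → Lcoef ks m))
    ∎
  where
  open ≡-Reasoning
  L₂ = atHeight s (λ ks → Lcoef (1 ∷ ks) (suc (suc m)))
  L₀ = atHeight s (λ ks → Lcoef (1 ∷ ks) m)
  pointwise : ∀ ks → fromℕ (suc (suc m)) * L₂ ks - fromℕ m * L₀ ks ≡ atHeight s (λ ks → Lcoef ks m) ks
  pointwise ks with height ks ≡ᵇ s
  ... | true  = Lcoef-1∷-recurrence ks m
  ... | false = cong₂ _-_ (*-zeroʳ (fromℕ (suc (suc m)))) (*-zeroʳ (fromℕ m))

Ψ : Series
Ψ a b c m = sumComp (a ℕ.+ (b ℕ.+ c) ℕ.+ c) (b ℕ.+ c) (atHeight c (λ ks → Lcoef (1 ∷ ks) m))

Φ₀-sumComp : ∀ a b c m → Φ₀ a b c m ≡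
  sumComp (a ℕ.+ (b ℕ.+ suc c) ℕ.+ suc c) (b ℕ.+ suc c) (admissibleOnly (atHeight (suc c) (λ ks → Lcoef ks m)))
Φ₀-sumComp a b c m =
  trans (sumL-map-filterᵇ (λ ks → Lcoef ks m) (λ ks → admissible ks ∧ (height ks ≡ᵇ suc c)) (compositions k n))
        (sumComp-cong k n guards)
  where
  n = b ℕ.+ suc c
  k = a ℕ.+ n ℕ.+ suc c
  guards : ∀ ks → (if admissible ks ∧ (height ks ≡ᵇ suc c) then Lcoef ks m else 0ℚ)
                  ≡ admissibleOnly (atHeight (suc c) (λ ks → Lcoef ks m)) ks
  guards ks with admissible ks
  ... | true  = refl
  ... | false = refl

weight-suc : ∀ a n s → a ℕ.+ suc n ℕ.+ s ≡ suc (a ℕ.+ n ℕ.+ s)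
weight-suc a n s = cong (ℕ._+ s) (ℕ.+-suc a n)

weight-suc-suc : ∀ a n s → a ℕ.+ suc n ℕ.+ suc s ≡ suc (suc (a ℕ.+ n ℕ.+ s))
weight-suc-suc a n s = trans (ℕ.+-suc (a ℕ.+ suc n) s) (cong (λ x → suc (x ℕ.+ s)) (ℕ.+-suc a n))

-- Weights are written a + n + s, with a the exponent of u.
sumComp-split-excess : ∀ a n s F →
  sumComp (a ℕ.+ suc n ℕ.+ s) (suc n) F
  ≡ sumComp (a ℕ.+ suc n ℕ.+ s) (suc n) (admissibleOnly F) + sumComp (a ℕ.+ n ℕ.+ s) n (λ ks → F (1 ∷ ks))
sumComp-split-excess a n s F = begin
  sumComp (a ℕ.+ suc n ℕ.+ s) (suc n) F                          ≡⟨ cong (λ w → sumComp w (suc n) F) (weight-suc a n s) ⟩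
  sumComp (suc (a ℕ.+ n ℕ.+ s)) (suc n) F                        ≡⟨ sumComp-split (a ℕ.+ n ℕ.+ s) n F ⟩
  sumComp (suc (a ℕ.+ n ℕ.+ s)) (suc n) (admissibleOnly F) + ones ≡⟨ cong (λ w → sumComp w (suc n) (admissibleOnly F) + ones)
                                                                           (weight-suc a n s) ⟨
  sumComp (a ℕ.+ suc n ℕ.+ s) (suc n) (admissibleOnly F) + ones   ∎
  where
  open ≡-Reasoning
  ones = sumComp (a ℕ.+ n ℕ.+ s) n (λ ks → F (1 ∷ ks))

sumComp-lowerHead-excess : ∀ a n s m →
  fromℕ m * sumComp (a ℕ.+ suc n ℕ.+ suc s) (suc n) (admissibleOnly (atHeight (suc s) (λ ks → Lcoef ks m)))
  ≡ shift₁ 1 (λ a′ → sumComp (a′ ℕ.+ suc n ℕ.+ suc s) (suc n)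
                               (admissibleOnly (atHeight (suc s) (λ ks → Lcoef ks m)))) a
    + sumComp (a ℕ.+ n ℕ.+ s) n (atHeight s (λ ks → Lcoef (1 ∷ ks) m))
sumComp-lowerHead-excess a n s m =
  trans (cong (λ w → fromℕ m * sumComp w (suc n) A) (weight-suc-suc a n s))
        (trans (sumComp-lowerHead (a ℕ.+ n ℕ.+ s) n s m) (cong (_+ ones) (lower-excess a)))
  where
  A = admissibleOnly (atHeight (suc s) (λ ks → Lcoef ks m))
  ones = sumComp (a ℕ.+ n ℕ.+ s) n (atHeight s (λ ks → Lcoef (1 ∷ ks) m))
  lower-excess : ∀ a → sumComp (suc (a ℕ.+ n ℕ.+ s)) (suc n) A
                       ≡ shift₁ 1 (λ a′ → sumComp (a′ ℕ.+ suc n ℕ.+ suc s) (suc n) A) a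
  lower-excess zero    = sumComp-vanish (suc (n ℕ.+ s)) (suc n) (suc s) (admissibleOnly-supported (suc s) _)
                                        (inj₁ (ℕ.s≤s (ℕ.+-monoʳ-< n (ℕ.n<1+n s))))
  lower-excess (suc a) = sym (cong (λ w → sumComp w (suc n) A) (weight-suc-suc a n s))

Ψ≈zΦ₀′-uΦ₀ : Ψ ≈ shift 0 0 0 1 (D Φ₀) ⊖ shift 1 0 0 0 Φ₀
Ψ≈zΦ₀′-uΦ₀ a b c m = sym (begin
  shift₁ 1 (D Φ₀ a b c) m - shift₁ 1 (λ a′ → Φ₀ a′ b c m) a
    ≡⟨ cong₂ _-_ (trans (shift₁-D (Φ₀ a b c) m) (cong (fromℕ m *_) (Φ₀-excess a)))
                 (shift₁-cong 1 Φ₀-excess a) ⟩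
  fromℕ m * A a - shift₁ 1 A a
    ≡⟨ cong (_- shift₁ 1 A a) (sumComp-lowerHead-excess a (b ℕ.+ c) c m) ⟩
  shift₁ 1 A a + Ψ a b c m - shift₁ 1 A a
    ≡⟨ [x+y]-x≡y (shift₁ 1 A a) (Ψ a b c m) ⟩
  Ψ a b c m
    ∎)
  where
  open ≡-Reasoning
  G = admissibleOnly (atHeight (suc c) (λ ks → Lcoef ks m))
  A : ℕ → ℚ
  A a′ = sumComp (a′ ℕ.+ suc (b ℕ.+ c) ℕ.+ suc c) (suc (b ℕ.+ c)) G
  Φ₀-excess : ∀ a′ → Φ₀ a′ b c m ≡ A a′
  Φ₀-excess a′ = trans (Φ₀-sumComp a′ b c m) (cong (λ n → sumComp (a′ ℕ.+ n ℕ.+ suc c) n G) (ℕ.+-suc b c))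

Ψ-recurrence : ∀ a b c m →
  fromℕ (suc (suc m)) * Ψ a b c (suc (suc m)) - fromℕ m * Ψ a b c m
  ≡ shift₁ 1 (λ c′ → Φ₀ a b c′ m) c + shift₁ 1 (λ b′ → Ψ a b′ c m) b
Ψ-recurrence a b c m =
  trans (sumComp-Lcoef-1∷-recurrence (a ℕ.+ (b ℕ.+ c) ℕ.+ c) (b ℕ.+ c) c m) (by-first-entry b c)
  where
  L = λ ks → Lcoef ks m
  by-first-entry : ∀ b c → sumComp (a ℕ.+ (b ℕ.+ c) ℕ.+ c) (b ℕ.+ c) (atHeight c L)
                           ≡ shift₁ 1 (λ c′ → Φ₀ a b c′ m) c + shift₁ 1 (λ b′ → Ψ a b′ c m) b
  by-first-entry zero    zero    = sumComp-depth-zero (a ℕ.+ 0 ℕ.+ 0) (Lcoef-[] m)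
  by-first-entry (suc b) c =
    trans (sumComp-split-excess a (b ℕ.+ c) c (atHeight c L)) (cong (_+ Ψ a b c m) (admissible-part c))
    where
    admissible-part : ∀ c → sumComp (a ℕ.+ suc (b ℕ.+ c) ℕ.+ c) (suc (b ℕ.+ c)) (admissibleOnly (atHeight c L))
                            ≡ shift₁ 1 (λ c′ → Φ₀ a (suc b) c′ m) c
    admissible-part zero    = sumComp-zero (a ℕ.+ suc (b ℕ.+ 0) ℕ.+ 0) (suc (b ℕ.+ 0)) (admissibleOnly-atHeight-zero L)
    admissible-part (suc c) = sym (Φ₀-sumComp a (suc b) c m)
  by-first-entry zero (suc c) =
    trans (sumComp-split-excess a c (suc c) (atHeight (suc c) L))
          (cong₂ _+_ (sym (Φ₀-sumComp a 0 c m))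
                     (sumComp-vanish (a ℕ.+ c ℕ.+ suc c) c (suc c) (atHeight-supported (suc c) _) (inj₂ (ℕ.n<1+n c))))

sumComp-Lcoef-1∷-at-1 : ∀ k n s → sumComp k (suc n) (atHeight s (λ ks → Lcoef (1 ∷ ks) 1)) ≡ 0ℚ
sumComp-Lcoef-1∷-at-1 k n s = trans (sumComp-head k n _)
  (sumL-applyUpTo-zero k _ (λ j _ → sumComp-zero (k ∸ suc j) n (λ ks → if-eta (height (suc j ∷ ks) ≡ᵇ s))))

-- The constant 1 of the differential equation: (1 − z²) 𝓛′_{(1)} = 1.
Ψ-at-1 : ∀ a b c → Ψ a b c 1 ≡ 𝟙 a b c 0
Ψ-at-1 zero    zero    zero    = refl
Ψ-at-1 (suc a) zero    zero    = refl
Ψ-at-1 zero    (suc b) c       = sumComp-Lcoef-1∷-at-1 (0 ℕ.+ suc (b ℕ.+ c) ℕ.+ c) (b ℕ.+ c) c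
Ψ-at-1 (suc a) (suc b) c       = sumComp-Lcoef-1∷-at-1 (suc a ℕ.+ suc (b ℕ.+ c) ℕ.+ c) (b ℕ.+ c) c
Ψ-at-1 zero    zero    (suc c) = sumComp-Lcoef-1∷-at-1 (0 ℕ.+ suc c ℕ.+ suc c) c (suc c)
Ψ-at-1 (suc a) zero    (suc c) = sumComp-Lcoef-1∷-at-1 (suc a ℕ.+ suc c ℕ.+ suc c) c (suc c)

𝟙-suc : ∀ a b c m → 𝟙 a b c (suc m) ≡ 0ℚ
𝟙-suc (suc a) b       c       m = refl
𝟙-suc zero    (suc b) c       m = refl
𝟙-suc zero    zero    (suc c) m = refl
𝟙-suc zero    zero    zero    m = refl

[1-z²]Ψ′≈1+z[wΦ₀+vΨ] : D Ψ ⊖ shift 0 0 0 2 (D Ψ) ≈ 𝟙 ⊕ shift 0 0 1 1 Φ₀ ⊕ shift 0 1 0 1 Ψ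
[1-z²]Ψ′≈1+z[wΦ₀+vΨ] a b c zero = begin
  fromℕ 1 * Ψ a b c 1 - 0ℚ    ≡⟨ +-identityʳ _ ⟩
  fromℕ 1 * Ψ a b c 1         ≡⟨ *-identityˡ _ ⟩
  Ψ a b c 1                   ≡⟨ Ψ-at-1 a b c ⟩
  𝟙 a b c 0                   ≡⟨ +-identityʳ _ ⟨
  𝟙 a b c 0 + 0ℚ              ≡⟨ +-identityʳ _ ⟨
  𝟙 a b c 0 + 0ℚ + 0ℚ         ≡⟨ cong₂ (λ x y → 𝟙 a b c 0 + x + y) (shift₁-zero 1 (λ _ → refl) c)
                                                                    (shift₁-zero 1 (λ _ → refl) b) ⟨
  𝟙 a b c 0 + wzΦ₀ + vzΨ      ∎
  where
  open ≡-Reasoning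
  wzΦ₀ = shift₁ 1 (λ c′ → shift₁ 1 (Φ₀ a b c′) 0) c
  vzΨ = shift₁ 1 (λ b′ → shift₁ 1 (Ψ a b′ c) 0) b
[1-z²]Ψ′≈1+z[wΦ₀+vΨ] a b c (suc m) = begin
  fromℕ (suc (suc m)) * Ψ a b c (suc (suc m)) - shift₁ 1 (D Ψ a b c) m
    ≡⟨ cong (fromℕ (suc (suc m)) * Ψ a b c (suc (suc m)) -_) (shift₁-D (Ψ a b c) m) ⟩
  fromℕ (suc (suc m)) * Ψ a b c (suc (suc m)) - fromℕ m * Ψ a b c m
    ≡⟨ Ψ-recurrence a b c m ⟩
  wzΦ₀ + vzΨ
    ≡⟨ cong (_+ vzΨ) (trans (cong (_+ wzΦ₀) (𝟙-suc a b c m)) (+-identityˡ wzΦ₀)) ⟨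
  𝟙 a b c (suc m) + wzΦ₀ + vzΨ
    ∎
  where
  open ≡-Reasoning
  wzΦ₀ = shift₁ 1 (λ c′ → Φ₀ a b c′ m) c
  vzΨ = shift₁ 1 (λ b′ → Ψ a b′ c m) b

proposition3p1 : (a b c m : ℕ) → ODE-LHS Φ₀ a b c m ≡ 𝟙 a b c m
proposition3p1 a b c m = begin
  ODE-LHS Φ₀ a b c m
    ≡⟨ ODE-LHS-factor Φ₀ Ψ Ψ≈zΦ₀′-uΦ₀ a b c m ⟩
  (D Ψ ⊖ shift 0 0 0 2 (D Ψ)) a b c m - (wzΦ₀ + vzΨ)
    ≡⟨ cong (_- (wzΦ₀ + vzΨ)) ([1-z²]Ψ′≈1+z[wΦ₀+vΨ] a b c m) ⟩
  𝟙 a b c m + wzΦ₀ + vzΨ - (wzΦ₀ + vzΨ)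
    ≡⟨ cancel (𝟙 a b c m) wzΦ₀ vzΨ ⟩
  𝟙 a b c m
    ∎
  where
  open ≡-Reasoning
  wzΦ₀ = shift 0 0 1 1 Φ₀ a b c m
  vzΨ = shift 0 1 0 1 Ψ a b c m
  cancel : ∀ x y z → x + y + z - (y + z) ≡ x
  cancel = solve 3 (λ x y z → x :+ y :+ z :- (y :+ z) := x) refl
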